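{- For any integer $n\geq 1$, $$\Phi(C_{2n+1})= \binom{n+1}{2}.$$
   Context: $C_m$ denotes the cycle with vertices $0,1,\dots,m-1$ and edges $\{i,i+1 \bmod m\}$. For a connected graph $G$, a path system of $G$ is a set consisting of one chosen path in $G$ connecting $a$ and $b$ for each unordered pair $\{a,b\}$ of distinct vertices. A global packing of $(G,\mathcal{P})$ is a map $\omega:\mathcal{P}\to\{1,\dots,k\}$ such that $\omega(P)\neq\omega(P')$ whenever distinct paths $P,P'\in\mathcal{P}$ share at least one edge; $\Phi(G,\mathcal{P})$ is the minimum such $k$, and $\Phi(G)$ is the minimum of $\Phi(G,\mathcal{P})$ over all path systems of $G$. -}

module Defs where

open import Data.Nat using (ℕ; zero; suc; _+_; _*_; _≤_)
open import Data.Fin using (Fin; toℕ; _<_)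
open import Data.List using (List; []; _∷_)
open import Data.List.Relation.Unary.Unique.Propositional using (Unique)
open import Data.Product using (Σ; ∃; _×_; proj₁)
open import Data.Sum using (_⊎_)
open import Relation.Nullary using (¬_)
open import Relation.Binary.PropositionalEquality using (_≡_; _≢_)

Graph : ℕ → Set₁
Graph m = Fin m → Fin m → Set

IsSucc : (m : ℕ) → Fin m → Fin m → Set
IsSucc m i j = toℕ j ≡ suc (toℕ i) ⊎ (suc (toℕ i) ≡ m × toℕ j ≡ 0)

Cycle : (m : ℕ) → Graph m
Cycle m i j = IsSucc m i j ⊎ IsSucc m j i

data IsWalk {m : ℕ} (G : Graph m) : Fin m → Fin m → List (Fin m) → Set where
  single : ∀ {a} → IsWalk G a a (a ∷ [])
  step   : ∀ {a v b vs} → G a v → IsWalk G v b (v ∷ vs) → IsWalk G a b (a ∷ v ∷ vs)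

IsPath : {m : ℕ} → Graph m → Fin m → Fin m → List (Fin m) → Set
IsPath G a b p = IsWalk G a b p × Unique p

data Consecutive {m : ℕ} (x y : Fin m) : List (Fin m) → Set where
  here  : ∀ {vs} → Consecutive x y (x ∷ y ∷ vs)
  there : ∀ {v vs} → Consecutive x y vs → Consecutive x y (v ∷ vs)

HasEdge : {m : ℕ} → List (Fin m) → Fin m → Fin m → Set
HasEdge p x y = Consecutive x y p ⊎ Consecutive y x p

ShareEdge : {m : ℕ} → List (Fin m) → List (Fin m) → Set
ShareEdge {m} p q = Σ (Fin m) λ x → Σ (Fin m) λ y → HasEdge p x y × HasEdge q x y

-- A path system: for each unordered pair {a,b} of distinct vertices
-- (represented as a < b) one chosen path of G connecting a and b.
PathSystem : {m : ℕ} → Graph m → Set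
PathSystem {m} G = (a b : Fin m) → a < b → Σ (List (Fin m)) (IsPath G a b)

pathOf : {m : ℕ} {G : Graph m} → PathSystem G → (a b : Fin m) → a < b → List (Fin m)
pathOf P a b h = proj₁ (P a b h)

-- A global packing of (G, P) with colours {1..k} (here Fin k):
-- paths for distinct pairs sharing an edge get distinct colours.
GlobalPacking : {m : ℕ} (G : Graph m) → PathSystem G → ℕ → Set
GlobalPacking {m} G P k =
  Σ ((a b : Fin m) → a < b → Fin k) λ ω →
    (a b a' b' : Fin m) (h : a < b) (h' : a' < b') →
    ¬ (a ≡ a' × b ≡ b') →
    ShareEdge (pathOf P a b h) (pathOf P a' b' h') →
    ω a b h ≢ ω a' b' h'

-- Φ(G) = k : k is the minimum number of colours of a global packing
-- over all path systems of G.
Phi≡ : {m : ℕ} → Graph m → ℕ → Set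
Phi≡ G k =
  (Σ (PathSystem G) λ P → GlobalPacking G P k) ×
  ((P : PathSystem G) (k' : ℕ) → GlobalPacking G P k' → k ≤ k')

-- Upper bound: route every pair along its shorter arc and fold each vertex w onto
-- {0, …, n}, identifying w with w + n.  Colour the pair {x, y} by the pair of folded
-- endpoints, or by {0, fold x} when x and y fold together; these are pairs i < j ≤ n, so
-- there are C(n+1, 2) colours.  No chosen arc has a vertex of its own colour class in its
-- interior, so the arcs of one colour are gaps between consecutive class vertices, and two
-- of them sharing an edge coincide.
--
-- Lower bound: a walk between vertices at cyclic distance d traverses one of the two arcs
-- between them, hence uses at least d edges.  For each d ≤ n there are 2n+1 pairs at
-- distance d, so the paths use at least (2n+1) C(n+1, 2) edges in total.  Averaging over
-- the 2n+1 edges, some edge lies on C(n+1, 2) paths, and these need distinct colours.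

module Submission where

open import Defs
open import Data.Nat
open import Data.Nat.Properties
open import Data.Nat.Combinatorics using (_C_; nC1≡n; nCk+nC[k+1]≡[n+1]C[k+1])
open import Data.Nat.DivMod using (_mod_; m<n⇒m%n≡m; n%n≡0)
open import Data.Nat.Tactic.RingSolver using (solve-∀)
open import Data.Fin as Fin using (Fin; toℕ; fromℕ<)
open import Data.Fin.Properties using (toℕ-fromℕ<; toℕ<n; toℕ-injective)
open import Data.List using (List; []; _∷_; _++_; head; last)
open import Data.List.Membership.Propositional using (_∈_)
open import Data.List.Relation.Unary.Any using (here; there)
import Data.List.Relation.Unary.All as All
open import Data.List.Relation.Unary.All using ([]; _∷_)
open import Data.List.Relation.Unary.AllPairs using ([]; _∷_)
import Data.List.Relation.Unary.Unique.Propositional.Properties as Unique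
open import Data.List.Relation.Unary.Unique.Propositional using (Unique)
open import Data.Maybe using (just)
open import Data.Maybe.Properties using (just-injective)
open import Data.Product using (∃; ∃₂; _×_; _,_; proj₁; proj₂)
open import Data.Sum using (_⊎_; inj₁; inj₂; [_,_]′)
open import Data.Empty using (⊥; ⊥-elim)
open import Function using (_∘_; id)
open import Relation.Nullary using (¬_; ¬?; Dec; yes; no)
open import Relation.Nullary.Decidable using (_⊎-dec_; _×-dec_; decidable-stable)
open import Relation.Unary using (Decidable)
open import Relation.Binary.PropositionalEquality
open import Relation.Binary.Definitions using (tri<; tri≈; tri>)

∑< : ℕ → (ℕ → ℕ) → ℕ
∑< zero    f = 0
∑< (suc k) f = f k + ∑< k f

syntax ∑< k (λ i → e) = ∑[ i < k ] e

∑-cong : ∀ k {f g} → (∀ i → i < k → f i ≡ g i) → ∑< k f ≡ ∑< k g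
∑-cong zero    f≡g = refl
∑-cong (suc k) f≡g = cong₂ _+_ (f≡g k ≤-refl) (∑-cong k λ i i<k → f≡g i (m<n⇒m<1+n i<k))

∑-mono-≤ : ∀ k {f g} → (∀ i → i < k → f i ≤ g i) → ∑< k f ≤ ∑< k g
∑-mono-≤ zero    f≤g = z≤n
∑-mono-≤ (suc k) f≤g = +-mono-≤ (f≤g k ≤-refl) (∑-mono-≤ k λ i i<k → f≤g i (m<n⇒m<1+n i<k))

∑-zero : ∀ k {f} → (∀ i → i < k → f i ≡ 0) → ∑< k f ≡ 0
∑-zero zero    f≡0 = refl
∑-zero (suc k) f≡0 = cong₂ _+_ (f≡0 k ≤-refl) (∑-zero k λ i i<k → f≡0 i (m<n⇒m<1+n i<k))

∑-const : ∀ k c → ∑[ _ < k ] c ≡ k * c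
∑-const zero    c = refl
∑-const (suc k) c = cong (c +_) (∑-const k c)

∑-distrib-+ : ∀ k f g → ∑[ i < k ] (f i + g i) ≡ ∑< k f + ∑< k g
∑-distrib-+ zero    f g = refl
∑-distrib-+ (suc k) f g = begin
  (f k + g k) + ∑[ i < k ] (f i + g i) ≡⟨ cong ((f k + g k) +_) (∑-distrib-+ k f g) ⟩
  (f k + g k) + (∑< k f + ∑< k g)      ≡⟨ interchange (f k) (g k) (∑< k f) (∑< k g) ⟩
  (f k + ∑< k f) + (g k + ∑< k g)      ∎
  where
  open ≡-Reasoning
  interchange : ∀ a b c d → (a + b) + (c + d) ≡ (a + c) + (b + d)
  interchange = solve-∀

∑-comm : ∀ j k (f : ℕ → ℕ → ℕ) → ∑[ x < j ] ∑[ y < k ] f x y ≡ ∑[ y < k ] ∑[ x < j ] f x y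
∑-comm zero    k f = sym (∑-zero k λ _ _ → refl)
∑-comm (suc j) k f = trans (cong (∑< k (f j) +_) (∑-comm j k f))
                           (sym (∑-distrib-+ k (f j) λ y → ∑[ x < j ] f x y))

∑-*-distribˡ : ∀ k c f → ∑[ i < k ] (c * f i) ≡ c * ∑< k f
∑-*-distribˡ zero    c f = sym (*-zeroʳ c)
∑-*-distribˡ (suc k) c f = trans (cong (c * f k +_) (∑-*-distribˡ k c f)) (sym (*-distribˡ-+ c (f k) (∑< k f)))

∑-monoˡ-≤ : ∀ f {j k} → j ≤ k → ∑< j f ≤ ∑< k f
∑-monoˡ-≤ f {k = zero}  z≤n = ≤-refl
∑-monoˡ-≤ f {j} {suc k} j≤1+k with m≤n⇒m<n∨m≡n j≤1+k
... | inj₂ refl = ≤-refl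
... | inj₁ j<1+k = ≤-trans (∑-monoˡ-≤ f (≤-pred j<1+k)) (m≤n+m (∑< k f) (f k))

∑-positive-tail : ∀ f {j k} → j ≤ k → (∀ i → j ≤ i → i < k → 1 ≤ f i) → ∑< j f + (k ∸ j) ≤ ∑< k f
∑-positive-tail f {j} {zero}  z≤n _ = ≤-reflexive (+-identityʳ 0)
∑-positive-tail f {j} {suc k} j≤1+k pos with m≤n⇒m<n∨m≡n j≤1+k
... | inj₂ refl = ≤-reflexive (trans (cong (∑< (suc k) f +_) (n∸n≡0 (suc k))) (+-identityʳ _))
... | inj₁ j<1+k = begin
  ∑< j f + (suc k ∸ j)    ≡⟨ cong (∑< j f +_) (+-∸-assoc 1 j≤k) ⟩
  ∑< j f + suc (k ∸ j)    ≡⟨ +-suc (∑< j f) (k ∸ j) ⟩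
  suc (∑< j f + (k ∸ j))  ≤⟨ s≤s (∑-positive-tail f j≤k λ i j≤i i<k → pos i j≤i (m<n⇒m<1+n i<k)) ⟩
  suc (∑< k f)            ≤⟨ +-monoˡ-≤ (∑< k f) (pos k j≤k ≤-refl) ⟩
  f k + ∑< k f            ∎
  where
  open ≤-Reasoning
  j≤k = ≤-pred j<1+k

∑-positive : ∀ k f → 1 ≤ ∑< k f → ∃ λ i → i < k × 1 ≤ f i
∑-positive zero    f ()
∑-positive (suc k) f 1≤∑ with 1 ≤? f k
... | yes 1≤fk = k , ≤-refl , 1≤fk
... | no  1≰fk with ∑-positive k f (subst (λ x → 1 ≤ x + ∑< k f) (n<1⇒n≡0 (≰⇒> 1≰fk)) 1≤∑)
...   | i , i<k , 1≤fi = i , m<n⇒m<1+n i<k , 1≤fi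

∑-≤1 : ∀ k f → (∀ i → i < k → f i ≤ 1) →
       (∀ i j → i < k → j < k → 1 ≤ f i → 1 ≤ f j → i ≡ j) → ∑< k f ≤ 1
∑-≤1 zero    f f≤1 unique = z≤n
∑-≤1 (suc k) f f≤1 unique with 1 ≤? f k
... | no 1≰fk = subst (λ x → x + ∑< k f ≤ 1) (sym (n<1⇒n≡0 (≰⇒> 1≰fk)))
                  (∑-≤1 k f (λ i i<k → f≤1 i (m<n⇒m<1+n i<k))
                            (λ i j i<k j<k → unique i j (m<n⇒m<1+n i<k) (m<n⇒m<1+n j<k)))
... | yes 1≤fk = begin
  f k + ∑< k f ≡⟨ cong (f k +_) (∑-zero k others-vanish) ⟩
  f k + 0      ≡⟨ +-identityʳ (f k) ⟩
  f k          ≤⟨ f≤1 k ≤-refl ⟩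
  1            ∎
  where
  open ≤-Reasoning
  others-vanish : ∀ i → i < k → f i ≡ 0
  others-vanish i i<k =
    n<1⇒n≡0 (≰⇒> λ 1≤fi → <-irrefl (unique i k (m<n⇒m<1+n i<k) ≤-refl 1≤fi 1≤fk) i<k)

indicator : ∀ {p} {P : Set p} → Dec P → ℕ
indicator (yes _) = 1
indicator (no _)  = 0

indicator≤1 : ∀ {p} {P : Set p} (P? : Dec P) → indicator P? ≤ 1
indicator≤1 (yes _) = s≤s z≤n
indicator≤1 (no _)  = z≤n

indicator-intro : ∀ {p} {P : Set p} (P? : Dec P) → P → 1 ≤ indicator P?
indicator-intro (yes _) _  = s≤s z≤n
indicator-intro (no ¬p) p = ⊥-elim (¬p p)

indicator-elim : ∀ {p} {P : Set p} (P? : Dec P) → 1 ≤ indicator P? → P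
indicator-elim (yes p) _ = p
indicator-elim (no _)  ()

∑-indicator-≡ : ∀ k {x} → x < k → ∑[ c < k ] indicator (x ≟ c) ≡ 1
∑-indicator-≡ (suc k) {x} x<1+k with x ≟ k
... | yes refl = cong suc (∑-zero k λ c c<k → others c c<k)
  where
  others : ∀ c → c < k → indicator (k ≟ c) ≡ 0
  others c c<k with k ≟ c
  ... | yes refl = ⊥-elim (<-irrefl refl c<k)
  ... | no _     = refl
... | no x≢k = ∑-indicator-≡ k (≤∧≢⇒< (≤-pred x<1+k) x≢k)

∑∑-injective-colouring-≤ : ∀ A B k (f col : ℕ → ℕ → ℕ) →
  (∀ a b → a < A → b < B → f a b ≤ 1) →
  (∀ a b → a < A → b < B → col a b < k) →
  (∀ a b a′ b′ → a < A → b < B → a′ < A → b′ < B →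
     1 ≤ f a b → 1 ≤ f a′ b′ → col a b ≡ col a′ b′ → a ≡ a′ × b ≡ b′) →
  ∑[ a < A ] ∑[ b < B ] f a b ≤ k
∑∑-injective-colouring-≤ A B k f col f≤1 col<k injective = begin
  ∑[ a < A ] ∑[ b < B ] f a b
    ≡⟨ ∑-cong A (λ a a<A → ∑-cong B λ b b<B → split-by-colour a b a<A b<B) ⟩
  ∑[ a < A ] ∑[ b < B ] ∑[ c < k ] H c a b
    ≡⟨ ∑-cong A (λ a _ → ∑-comm B k (λ b c → H c a b)) ⟩
  ∑[ a < A ] ∑[ c < k ] ∑[ b < B ] H c a b
    ≡⟨ ∑-comm A k (λ a c → ∑[ b < B ] H c a b) ⟩
  ∑[ c < k ] ∑[ a < A ] ∑[ b < B ] H c a b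
    ≤⟨ ∑-mono-≤ k (λ c _ → colour-class≤1 c) ⟩
  ∑[ _ < k ] 1
    ≡⟨ ∑-const k 1 ⟩
  k * 1
    ≡⟨ *-identityʳ k ⟩
  k ∎
  where
  open ≤-Reasoning

  H : ℕ → ℕ → ℕ → ℕ
  H c a b = f a b * indicator (col a b ≟ c)

  split-by-colour : ∀ a b → a < A → b < B → f a b ≡ ∑[ c < k ] H c a b
  split-by-colour a b a<A b<B = sym (begin-equality
    ∑[ c < k ] H c a b                           ≡⟨ ∑-*-distribˡ k (f a b) (λ c → indicator (col a b ≟ c)) ⟩
    f a b * ∑[ c < k ] indicator (col a b ≟ c)  ≡⟨ cong (f a b *_) (∑-indicator-≡ k (col<k a b a<A b<B)) ⟩
    f a b * 1                                    ≡⟨ *-identityʳ (f a b) ⟩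
    f a b                                        ∎)

  H-elim : ∀ {c a b} → 1 ≤ H c a b → 1 ≤ f a b × col a b ≡ c
  H-elim {c} {a} {b} 1≤H with col a b ≟ c
  ... | yes col≡c = subst (1 ≤_) (*-identityʳ (f a b)) 1≤H , col≡c
  ... | no _      = ⊥-elim (<-irrefl (sym (*-zeroʳ (f a b))) 1≤H)

  same-pair : ∀ {c a b a′ b′} → a < A → b < B → a′ < A → b′ < B →
              1 ≤ H c a b → 1 ≤ H c a′ b′ → a ≡ a′ × b ≡ b′
  same-pair a<A b<B a′<A b′<B 1≤H 1≤H′ with H-elim 1≤H | H-elim 1≤H′
  ... | 1≤f , refl | 1≤f′ , col≡ = injective _ _ _ _ a<A b<B a′<A b′<B 1≤f 1≤f′ (sym col≡)

  colour-class≤1 : ∀ c → ∑[ a < A ] ∑[ b < B ] H c a b ≤ 1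
  colour-class≤1 c = ∑-≤1 A _
    (λ a a<A → ∑-≤1 B (H c a)
      (λ b b<B → *-mono-≤ (f≤1 a b a<A b<B) (indicator≤1 (col a b ≟ c)))
      (λ b b′ b<B b′<B 1≤H 1≤H′ → proj₂ (same-pair a<A b<B a<A b′<B 1≤H 1≤H′)))
    (λ a a′ a<A a′<A 1≤∑ 1≤∑′ →
      let b  , b<B  , 1≤H  = ∑-positive B (H c a) 1≤∑
          b′ , b′<B , 1≤H′ = ∑-positive B (H c a′) 1≤∑′
      in proj₁ (same-pair a<A b<B a′<A b′<B 1≤H 1≤H′))

∑-id≡C2 : ∀ j → ∑[ i < j ] i ≡ j C 2
∑-id≡C2 zero    = refl
∑-id≡C2 (suc j) = trans (cong₂ _+_ (sym (nC1≡n j)) (∑-id≡C2 j)) (nCk+nC[k+1]≡[n+1]C[k+1] j 1)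

∑-suc≡C2 : ∀ n → ∑[ l < n ] suc l ≡ suc n C 2
∑-suc≡C2 n = trans (sum-shift n) (∑-id≡C2 (suc n))
  where
  sum-shift : ∀ j → ∑[ l < j ] suc l ≡ ∑[ i < suc j ] i
  sum-shift zero    = refl
  sum-shift (suc j) = cong (suc j +_) (sum-shift j)

pairCode : ℕ → ℕ → ℕ
pairCode i j = ∑[ l < j ] l + i

pairCode<∑ : ∀ {i j} → i < j → pairCode i j < ∑[ l < suc j ] l
pairCode<∑ {i} {j} i<j = subst (pairCode i j <_) (+-comm (∑[ l < j ] l) j) (+-monoʳ-< (∑[ l < j ] l) i<j)

pairCode<C2 : ∀ {i j n} → i < j → j ≤ n → pairCode i j < suc n C 2
pairCode<C2 {n = n} i<j j≤n =
  <-≤-trans (pairCode<∑ i<j) (subst (_ ≤_) (∑-id≡C2 (suc n)) (∑-monoˡ-≤ (λ l → l) (s≤s j≤n)))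

pairCode-<-by-row : ∀ {i j i′ j′} → i < j → j < j′ → pairCode i j < pairCode i′ j′
pairCode-<-by-row {i′ = i′} i<j j<j′ =
  <-≤-trans (pairCode<∑ i<j) (≤-trans (∑-monoˡ-≤ (λ l → l) j<j′) (m≤m+n _ i′))

pairCode-injective : ∀ {i j i′ j′} → i < j → i′ < j′ → pairCode i j ≡ pairCode i′ j′ → i ≡ i′ × j ≡ j′
pairCode-injective {i} {j} {i′} {j′} i<j i′<j′ code≡ with <-cmp j j′
... | tri< j<j′ _ _ = ⊥-elim (<-irrefl code≡ (pairCode-<-by-row i<j j<j′))
... | tri> _ _ j′<j = ⊥-elim (<-irrefl (sym code≡) (pairCode-<-by-row i′<j′ j′<j))
... | tri≈ _ refl _ = +-cancelˡ-≡ (∑[ l < j ] l) i i′ code≡ , refl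

walk-∷ : ∀ {n} {G : Graph n} {a v b q} → G a v → IsWalk G v b q → IsWalk G a b (a ∷ q)
walk-∷ a~v w@single     = step a~v w
walk-∷ a~v w@(step _ _) = step a~v w

walk-++ : ∀ {n} {G : Graph n} {a c d b p q} → IsWalk G a c p → G c d → IsWalk G d b q → IsWalk G a b (p ++ q)
walk-++ single       c~d w = walk-∷ c~d w
walk-++ (step a~v w) c~d w′ = step a~v (walk-++ w c~d w′)

consecutive-∷ : ∀ {n} {u v a : Fin n} {q} → Consecutive u v (a ∷ q) →
                (u ≡ a × head q ≡ just v) ⊎ Consecutive u v q
consecutive-∷ here      = inj₁ (refl , refl)
consecutive-∷ (there c) = inj₂ c

consecutive-++ : ∀ {n} {u v : Fin n} xs {ys} → Consecutive u v (xs ++ ys) →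
                 Consecutive u v xs ⊎ (last xs ≡ just u × head ys ≡ just v) ⊎ Consecutive u v ys
consecutive-++ []               c         = inj₂ (inj₂ c)
consecutive-++ (_ ∷ [])         here      = inj₂ (inj₁ (refl , refl))
consecutive-++ (_ ∷ [])         (there c) = inj₂ (inj₂ c)
consecutive-++ (_ ∷ _ ∷ _)      here      = inj₁ here
consecutive-++ (_ ∷ x′ ∷ xs)    (there c) with consecutive-++ (x′ ∷ xs) c
... | inj₁ c′ = inj₁ (there c′)
... | inj₂ r  = inj₂ r

consecutive? : ∀ {n} (u v : Fin n) p → Dec (Consecutive u v p)
consecutive? u v []           = no λ ()
consecutive? u v (x ∷ [])     = no λ { (there ()) }
consecutive? u v (x ∷ y ∷ vs) with u Fin.≟ x | v Fin.≟ y | consecutive? u v (y ∷ vs)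
... | yes refl | yes refl | _      = yes here
... | _        | _        | yes c  = yes (there c)
... | no u≢x   | _        | no ¬c  = no λ { here → u≢x refl ; (there c) → ¬c c }
... | yes _    | no v≢y   | no ¬c  = no λ { here → v≢y refl ; (there c) → ¬c c }

walk-leaves : ∀ {n} {G : Graph n} (S : Fin n → Set) → Decidable S →
              ∀ {s t p} → IsWalk G s t p → S s → ¬ S t →
              ∃₂ λ w w′ → Consecutive w w′ p × G w w′ × S w × ¬ S w′
walk-leaves S S? single                 s∈S s∉S = ⊥-elim (s∉S s∈S)
walk-leaves S S? (step {v = v} s~v walk) s∈S t∉S with S? v
... | no v∉S = _ , v , here , s~v , s∈S , v∉S
... | yes v∈S with walk-leaves S S? walk v∈S t∉S
...   | w , w′ , c , w~w′ , w∈S , w′∉S = w , w′ , there c , w~w′ , w∈S , w′∉S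

packing-separates : ∀ {m k} (G : Graph m) (P : PathSystem G) ((ω , proper) : GlobalPacking G P k) →
                    ∀ {a b a′ b′ x y} (a<b : a Fin.< b) (a′<b′ : a′ Fin.< b′) →
                    HasEdge (pathOf P a b a<b) x y → HasEdge (pathOf P a′ b′ a′<b′) x y →
                    ω a b a<b ≡ ω a′ b′ a′<b′ → a ≡ a′ × b ≡ b′
packing-separates G P (ω , proper) {a} {b} {a′} {b′} {x} {y} a<b a′<b′ e e′ ω≡ with a Fin.≟ a′ | b Fin.≟ b′
... | yes a≡a′ | yes b≡b′ = a≡a′ , b≡b′
... | no  a≢a′ | _        = ⊥-elim (proper a b a′ b′ a<b a′<b′ (a≢a′ ∘ proj₁) (x , y , e , e′) ω≡)
... | yes _    | no b≢b′  = ⊥-elim (proper a b a′ b′ a<b a′<b′ (b≢b′ ∘ proj₂) (x , y , e , e′) ω≡)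

module CycleWalks (m : ℕ) .{{_ : NonZero m}} where

  vertex : ℕ → Fin m
  vertex z = z mod m

  toℕ-vertex : ∀ {z} → z < m → toℕ (vertex z) ≡ z
  toℕ-vertex z<m = trans (toℕ-fromℕ< _) (m<n⇒m%n≡m z<m)

  toℕ-vertex-m : toℕ (vertex m) ≡ 0
  toℕ-vertex-m = trans (toℕ-fromℕ< _) (n%n≡0 m)

  vertex-toℕ : (a : Fin m) → vertex (toℕ a) ≡ a
  vertex-toℕ a = toℕ-injective (toℕ-vertex (toℕ<n a))

  isSucc-vertex : ∀ {z} → suc z < m → IsSucc m (vertex z) (vertex (suc z))
  isSucc-vertex {z} 1+z<m =
    inj₁ (trans (toℕ-vertex 1+z<m) (cong suc (sym (toℕ-vertex (<-trans (n<1+n z) 1+z<m)))))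

  isSucc-wrap : IsSucc m (vertex (pred m)) (vertex 0)
  isSucc-wrap = inj₂ (trans (cong suc (toℕ-vertex pred<m)) (suc-pred m) , toℕ-vertex (>-nonZero⁻¹ m))
    where pred<m = subst (pred m <_) (suc-pred m) ≤-refl

  isSucc⇒≡vertex-suc : ∀ {u v} → IsSucc m u v → v ≡ vertex (suc (toℕ u))
  isSucc⇒≡vertex-suc {u} {v} (inj₁ v≡1+u) =
    toℕ-injective (trans v≡1+u (sym (toℕ-vertex (subst (_< m) v≡1+u (toℕ<n v)))))
  isSucc⇒≡vertex-suc {u} {v} (inj₂ (1+u≡m , v≡0)) =
    toℕ-injective (trans v≡0 (sym (trans (cong (toℕ ∘ vertex) 1+u≡m) toℕ-vertex-m)))

  isSucc-asym : 3 ≤ m → ∀ {u v} → IsSucc m u v → IsSucc m v u → ⊥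
  isSucc-asym _ {u} (inj₁ v≡1+u) (inj₁ u≡1+v) =
    <-irrefl (trans u≡1+v (cong suc v≡1+u)) (m<n⇒m<1+n (n<1+n (toℕ u)))
  isSucc-asym 3≤m (inj₁ v≡1+u) (inj₂ (1+v≡m , u≡0)) =
    <-irrefl (trans (cong (suc ∘ suc) (sym u≡0)) (trans (cong suc (sym v≡1+u)) 1+v≡m)) 3≤m
  isSucc-asym 3≤m (inj₂ (1+u≡m , v≡0)) (inj₁ u≡1+v) =
    <-irrefl (trans (cong (suc ∘ suc) (sym v≡0)) (trans (cong suc (sym u≡1+v)) 1+u≡m)) 3≤m
  isSucc-asym 3≤m (inj₂ (1+u≡m , v≡0)) (inj₂ (1+v≡m , u≡0)) =
    <-irrefl (trans (cong suc (sym v≡0)) 1+v≡m) (<-trans (s≤s (s≤s z≤n)) 3≤m)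

  ascending : ℕ → ℕ → List (Fin m)
  ascending x zero    = vertex x ∷ []
  ascending x (suc k) = vertex x ∷ ascending (suc x) k

  descending : ℕ → ℕ → List (Fin m)
  descending x zero    = vertex x ∷ []
  descending x (suc k) = vertex x ∷ descending (pred x) k

  ascending-walk : ∀ x k → x + k < m → IsWalk (Cycle m) (vertex x) (vertex (x + k)) (ascending x k)
  ascending-walk x zero    _       rewrite +-identityʳ x = single
  ascending-walk x (suc k) x+k+1<m rewrite +-suc x k =
    walk-∷ (inj₁ (isSucc-vertex (≤-<-trans (s≤s (m≤m+n x k)) x+k+1<m))) (ascending-walk (suc x) k x+k+1<m)

  descending-walk : ∀ x k → k ≤ x → x < m → IsWalk (Cycle m) (vertex x) (vertex (x ∸ k)) (descending x k)
  descending-walk x       zero    _         _   = single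
  descending-walk (suc x) (suc k) (s≤s k≤x) x<m =
    walk-∷ (inj₂ (isSucc-vertex x<m)) (descending-walk x k k≤x (<-trans (n<1+n x) x<m))

  toℕ-vertex-between : ∀ {z lo hi} → lo ≤ z → z ≤ hi → hi < m → lo ≤ toℕ (vertex z) × toℕ (vertex z) ≤ hi
  toℕ-vertex-between lo≤z z≤hi hi<m rewrite toℕ-vertex (≤-<-trans z≤hi hi<m) = lo≤z , z≤hi

  ∈-ascending : ∀ x k {v} → x + k < m → v ∈ ascending x k → x ≤ toℕ v × toℕ v ≤ x + k
  ∈-ascending x zero    x+k<m (here refl) = toℕ-vertex-between ≤-refl (m≤m+n x 0) x+k<m
  ∈-ascending x (suc k) x+k<m (here refl) = toℕ-vertex-between ≤-refl (m≤m+n x (suc k)) x+k<m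
  ∈-ascending x (suc k) {v} x+k<m (there v∈) with ∈-ascending (suc x) k (subst (_< m) (+-suc x k) x+k<m) v∈
  ... | lo , hi = ≤-trans (n≤1+n x) lo , subst (toℕ v ≤_) (sym (+-suc x k)) hi

  ∈-descending : ∀ x k {v} → k ≤ x → x < m → v ∈ descending x k → x ∸ k ≤ toℕ v × toℕ v ≤ x
  ∈-descending x       zero    _ x<m (here refl) = toℕ-vertex-between ≤-refl ≤-refl x<m
  ∈-descending x       (suc k) _ x<m (here refl) = toℕ-vertex-between (m∸n≤m x (suc k)) ≤-refl x<m
  ∈-descending (suc x) (suc k) (s≤s k≤x) x<m (there v∈) with ∈-descending x k k≤x (<-trans (n<1+n x) x<m) v∈
  ... | lo , hi = lo , ≤-trans hi (n≤1+n x)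

  ascending-unique : ∀ x k → x + k < m → Unique (ascending x k)
  ascending-unique x zero    _      = [] ∷ []
  ascending-unique x (suc k) x+k<m =
    All.tabulate (λ v∈ x≡v → <-irrefl (trans (sym (toℕ-vertex x<m)) (cong toℕ x≡v))
                                      (proj₁ (∈-ascending (suc x) k x+k<m′ v∈)))
    ∷ ascending-unique (suc x) k x+k<m′
    where
    x<m = ≤-<-trans (m≤m+n x (suc k)) x+k<m
    x+k<m′ = subst (_< m) (+-suc x k) x+k<m

  descending-unique : ∀ x k → k ≤ x → x < m → Unique (descending x k)
  descending-unique x       zero    _         _   = [] ∷ []
  descending-unique (suc x) (suc k) (s≤s k≤x) x<m =
    All.tabulate (λ v∈ x≡v → <-irrefl (trans (sym (cong toℕ x≡v)) (toℕ-vertex x<m))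
                                      (s≤s (proj₂ (∈-descending x k k≤x x<m′ v∈))))
    ∷ descending-unique x k k≤x x<m′
    where x<m′ = <-trans (n<1+n x) x<m

  head-ascending : ∀ x k → head (ascending x k) ≡ just (vertex x)
  head-ascending x zero    = refl
  head-ascending x (suc k) = refl

  head-descending : ∀ x k → head (descending x k) ≡ just (vertex x)
  head-descending x zero    = refl
  head-descending x (suc k) = refl

  last-descending : ∀ x k → k ≤ x → last (descending x k) ≡ just (vertex (x ∸ k))
  last-descending x       zero          _         = refl
  last-descending (suc x) (suc zero)    _         = refl
  last-descending (suc x) (suc (suc k)) (s≤s k≤x) = last-descending x (suc k) k≤x

  consecutive-ascending : ∀ x k {u v} → x + k < m → Consecutive u v (ascending x k) →
                          IsSucc m u v × x ≤ toℕ u × toℕ u < x + k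
  consecutive-ascending x zero    _     (there ())
  consecutive-ascending x (suc k) {u} x+k<m c with consecutive-∷ c
  ... | inj₁ (refl , head≡) =
    subst (IsSucc m (vertex x)) (just-injective (trans (sym (head-ascending (suc x) k)) head≡))
          (isSucc-vertex (≤-<-trans (s≤s (m≤m+n x k)) x+k<m′)) ,
    subst (λ i → x ≤ i × i < x + suc k) (sym (toℕ-vertex (≤-<-trans (m≤m+n x (suc k)) x+k<m)))
          (≤-refl , m<m+n x z<s)
    where x+k<m′ = subst (_< m) (+-suc x k) x+k<m
  ... | inj₂ c′ with consecutive-ascending (suc x) k (subst (_< m) (+-suc x k) x+k<m) c′
  ...   | u→v , lo , hi = u→v , ≤-trans (n≤1+n x) lo , subst (toℕ u <_) (sym (+-suc x k)) hi

  consecutive-descending : ∀ x k {u v} → k ≤ x → x < m → Consecutive u v (descending x k) →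
                           IsSucc m v u × x ∸ k ≤ toℕ v × toℕ v < x
  consecutive-descending x       zero    _         _   (there ())
  consecutive-descending (suc x) (suc k) {v = v} (s≤s k≤x) x<m c with consecutive-∷ c
  ... | inj₁ (refl , head≡) rewrite just-injective (trans (sym head≡) (head-descending x k)) =
    isSucc-vertex x<m ,
    subst (λ i → x ∸ k ≤ i × i < suc x) (sym (toℕ-vertex (<-trans (n<1+n x) x<m))) (m∸n≤m x k , n<1+n x)
  ... | inj₂ c′ with consecutive-descending x k k≤x (<-trans (n<1+n x) x<m) c′
  ...   | v→u , lo , hi = v→u , lo , <-trans hi (n<1+n x)

  EdgeAt : ℕ → Fin m → Fin m → Set
  EdgeAt z u v = (toℕ u ≡ z × IsSucc m u v) ⊎ (toℕ v ≡ z × IsSucc m v u)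

  EdgeAt-unique : 3 ≤ m → ∀ {z z′ u v} → EdgeAt z u v → EdgeAt z′ u v → z ≡ z′
  EdgeAt-unique _   (inj₁ (u≡z , _))   (inj₁ (u≡z′ , _))   = trans (sym u≡z) u≡z′
  EdgeAt-unique _   (inj₂ (v≡z , _))   (inj₂ (v≡z′ , _))   = trans (sym v≡z) v≡z′
  EdgeAt-unique 3≤m (inj₁ (_ , u→v))   (inj₂ (_ , v→u))    = ⊥-elim (isSucc-asym 3≤m u→v v→u)
  EdgeAt-unique 3≤m (inj₂ (_ , v→u))   (inj₁ (_ , u→v))    = ⊥-elim (isSucc-asym 3≤m u→v v→u)

  Uses : List (Fin m) → ℕ → Set
  Uses p z = HasEdge p (vertex z) (vertex (suc z))

  uses? : ∀ p z → Dec (Uses p z)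
  uses? p z = consecutive? _ _ p ⊎-dec consecutive? _ _ p

  EdgeAt⇒Uses : ∀ {z u v p} → EdgeAt z u v → Consecutive u v p → Uses p z
  EdgeAt⇒Uses {u = u} (inj₁ (refl , u→v)) c rewrite vertex-toℕ u | sym (isSucc⇒≡vertex-suc u→v) = inj₁ c
  EdgeAt⇒Uses {v = v} (inj₂ (refl , v→u)) c rewrite vertex-toℕ v | sym (isSucc⇒≡vertex-suc v→u) = inj₂ c

  leaving-interval : ∀ {z₁ z₂ w w′} → suc z₁ < m → Cycle m w w′ →
                     z₂ < toℕ w × toℕ w ≤ z₁ → ¬ (z₂ < toℕ w′ × toℕ w′ ≤ z₁) →
                     EdgeAt z₁ w w′ ⊎ EdgeAt z₂ w w′
  leaving-interval {z₁} {z₂} {w} {w′} _ (inj₁ w→w′@(inj₁ w′≡1+w)) (z₂<w , w≤z₁) w′∉ with toℕ w ≟ z₁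
  ... | yes w≡z₁ = inj₁ (inj₁ (w≡z₁ , w→w′))
  ... | no  w≢z₁ = ⊥-elim (w′∉ (subst (z₂ <_) (sym w′≡1+w) (<-trans z₂<w (n<1+n _)) ,
                                subst (_≤ z₁) (sym w′≡1+w) (≤∧≢⇒< w≤z₁ w≢z₁)))
  leaving-interval 1+z₁<m (inj₁ (inj₂ (1+w≡m , _))) (_ , w≤z₁) _ =
    ⊥-elim (<-irrefl 1+w≡m (≤-<-trans (s≤s w≤z₁) 1+z₁<m))
  leaving-interval {z₁} {z₂} {w} {w′} _ (inj₂ w′→w@(inj₁ w≡1+w′)) (z₂<w , w≤z₁) w′∉ with toℕ w′ ≟ z₂
  ... | yes w′≡z₂ = inj₂ (inj₂ (w′≡z₂ , w′→w))
  ... | no  w′≢z₂ = ⊥-elim (w′∉ (≤∧≢⇒< (≤-pred (subst (z₂ <_) w≡1+w′ z₂<w)) (w′≢z₂ ∘ sym) ,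
                                 ≤-trans (subst (toℕ w′ ≤_) (sym w≡1+w′) (n≤1+n _)) w≤z₁))
  leaving-interval _ (inj₂ (inj₂ (_ , w≡0))) (z₂<w , _) _ = ⊥-elim (n≮0 (subst (_ <_) w≡0 z₂<w))

  leaving-co-interval : ∀ {z₁ z₂ w w′} → z₂ < m → Cycle m w w′ →
                        toℕ w ≤ z₁ ⊎ z₂ < toℕ w → ¬ (toℕ w′ ≤ z₁ ⊎ z₂ < toℕ w′) →
                        EdgeAt z₁ w w′ ⊎ EdgeAt z₂ w w′
  leaving-co-interval {z₁} {z₂} {w} {w′} _ (inj₁ w→w′@(inj₁ w′≡1+w)) (inj₁ w≤z₁) w′∉ with toℕ w ≟ z₁
  ... | yes w≡z₁ = inj₁ (inj₁ (w≡z₁ , w→w′))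
  ... | no  w≢z₁ = ⊥-elim (w′∉ (inj₁ (subst (_≤ z₁) (sym w′≡1+w) (≤∧≢⇒< w≤z₁ w≢z₁))))
  leaving-co-interval {z₂ = z₂} _ (inj₁ (inj₁ w′≡1+w)) (inj₂ z₂<w) w′∉ =
    ⊥-elim (w′∉ (inj₂ (subst (z₂ <_) (sym w′≡1+w) (<-trans z₂<w (n<1+n _)))))
  leaving-co-interval {z₁} _ (inj₁ (inj₂ (_ , w′≡0))) _ w′∉ = ⊥-elim (w′∉ (inj₁ (subst (_≤ z₁) (sym w′≡0) z≤n)))
  leaving-co-interval {w′ = w′} _ (inj₂ (inj₁ w≡1+w′)) (inj₁ w≤z₁) w′∉ =
    ⊥-elim (w′∉ (inj₁ (≤-trans (subst (toℕ w′ ≤_) (sym w≡1+w′) (n≤1+n _)) w≤z₁)))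
  leaving-co-interval {z₂ = z₂} {w′ = w′} _ (inj₂ w′→w@(inj₁ w≡1+w′)) (inj₂ z₂<w) w′∉ with toℕ w′ ≟ z₂
  ... | yes w′≡z₂ = inj₂ (inj₂ (w′≡z₂ , w′→w))
  ... | no  w′≢z₂ = ⊥-elim (w′∉ (inj₂ (≤∧≢⇒< (≤-pred (subst (z₂ <_) w≡1+w′ z₂<w)) (w′≢z₂ ∘ sym))))
  leaving-co-interval {z₂ = z₂} {w′ = w′} z₂<m (inj₂ w′→w@(inj₂ (1+w′≡m , _))) _ w′∉ with toℕ w′ ≟ z₂
  ... | yes w′≡z₂ = inj₂ (inj₂ (w′≡z₂ , w′→w))
  ... | no  w′≢z₂ = ⊥-elim (w′∉ (inj₂ (≤∧≢⇒< (≤-pred (subst (z₂ <_) (sym 1+w′≡m) z₂<m)) (w′≢z₂ ∘ sym))))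

  -- Deleting the edges z₁ and z₂ separates s from t.
  walk-uses-cut : ∀ {s t p z₁ z₂} → IsWalk (Cycle m) s t p → toℕ s ≤ z₁ → z₁ < toℕ t → z₂ < m →
                  z₂ < toℕ s ⊎ toℕ t ≤ z₂ → Uses p z₁ ⊎ Uses p z₂
  walk-uses-cut {s} {t} {p} {z₁} {z₂} walk s≤z₁ z₁<t z₂<m (inj₁ z₂<s)
    with walk-leaves (λ w → z₂ < toℕ w × toℕ w ≤ z₁) (λ w → (z₂ <? toℕ w) ×-dec (toℕ w ≤? z₁)) walk
           (z₂<s , s≤z₁) (λ (_ , t≤z₁) → <⇒≱ z₁<t t≤z₁)
  ... | w , w′ , c , w~w′ , w∈ , w′∉ with leaving-interval (<-≤-trans (s≤s z₁<t) (toℕ<n t)) w~w′ w∈ w′∉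
  ...   | inj₁ at₁ = inj₁ (EdgeAt⇒Uses at₁ c)
  ...   | inj₂ at₂ = inj₂ (EdgeAt⇒Uses at₂ c)
  walk-uses-cut {s} {t} {p} {z₁} {z₂} walk s≤z₁ z₁<t z₂<m (inj₂ t≤z₂)
    with walk-leaves (λ w → toℕ w ≤ z₁ ⊎ z₂ < toℕ w) (λ w → (toℕ w ≤? z₁) ⊎-dec (z₂ <? toℕ w)) walk
           (inj₁ s≤z₁) (λ { (inj₁ t≤z₁) → <⇒≱ z₁<t t≤z₁ ; (inj₂ z₂<t) → <⇒≱ z₂<t t≤z₂ })
  ... | w , w′ , c , w~w′ , w∈ , w′∉ with leaving-co-interval z₂<m w~w′ w∈ w′∉
  ...   | inj₁ at₁ = inj₁ (EdgeAt⇒Uses at₁ c)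
  ...   | inj₂ at₂ = inj₂ (EdgeAt⇒Uses at₂ c)

  walk-covers-arc : ∀ {s t p} → IsWalk (Cycle m) s t p →
                    (∀ z → toℕ s ≤ z → z < toℕ t → Uses p z) ⊎
                    (∀ z → z < m → z < toℕ s ⊎ toℕ t ≤ z → Uses p z)
  walk-covers-arc {s} {t} {p} walk with anyUpTo? (λ z → (toℕ s ≤? z) ×-dec ¬? (uses? p z)) (toℕ t)
  ... | yes (z₁ , z₁<t , s≤z₁ , ¬uses) = inj₂ λ z₂ z₂<m outside →
          [ (λ uses₁ → ⊥-elim (¬uses uses₁)) , id ]′ (walk-uses-cut walk s≤z₁ z₁<t z₂<m outside)
  ... | no  none = inj₁ λ z s≤z z<t → decidable-stable (uses? p z) λ ¬uses → none (z , z<t , s≤z , ¬uses)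

  usedEdges : List (Fin m) → ℕ
  usedEdges p = ∑[ z < m ] indicator (uses? p z)

  walk-usedEdges : ∀ {s t p d} → IsWalk (Cycle m) s t p →
                   d + toℕ s ≤ toℕ t → d + toℕ t ≤ toℕ s + m → d ≤ usedEdges p
  walk-usedEdges {s} {t} {p} {d} walk d+s≤t d+t≤s+m with walk-covers-arc walk
  ... | inj₁ arc = begin
    d                                ≤⟨ m+n≤o⇒m≤o∸n d d+s≤t ⟩
    toℕ t ∸ toℕ s                    ≤⟨ m≤n+m _ _ ⟩
    ∑< (toℕ s) used + (toℕ t ∸ toℕ s) ≤⟨ ∑-positive-tail used s≤t (λ z s≤z z<t → covered z (arc z s≤z z<t)) ⟩
    ∑< (toℕ t) used                  ≤⟨ ∑-monoˡ-≤ used (<⇒≤ (toℕ<n t)) ⟩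
    usedEdges p                      ∎
    where
    open ≤-Reasoning
    used = λ z → indicator (uses? p z)
    s≤t = ≤-trans (m≤n+m (toℕ s) d) d+s≤t
    covered : ∀ z → Uses p z → 1 ≤ used z
    covered z = indicator-intro (uses? p z)
  ... | inj₂ co-arc = begin
    d                                 ≤⟨ m+n≤o⇒m≤o∸n d d+t≤s+m ⟩
    toℕ s + m ∸ toℕ t                 ≡⟨ +-∸-assoc (toℕ s) t≤m ⟩
    toℕ s + (m ∸ toℕ t)               ≤⟨ +-monoˡ-≤ (m ∸ toℕ t) (∑-positive-tail used z≤n λ z _ z<s →
                                           covered z (<-≤-trans z<s (≤-trans s≤t t≤m)) (inj₁ z<s)) ⟩
    ∑< (toℕ s) used + (m ∸ toℕ t)     ≤⟨ +-monoˡ-≤ (m ∸ toℕ t) (∑-monoˡ-≤ used s≤t) ⟩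
    ∑< (toℕ t) used + (m ∸ toℕ t)     ≤⟨ ∑-positive-tail used t≤m (λ z t≤z z<m → covered z z<m (inj₂ t≤z)) ⟩
    usedEdges p                       ∎
    where
    open ≤-Reasoning
    used = λ z → indicator (uses? p z)
    t≤m = <⇒≤ (toℕ<n t)
    s≤t = ≤-trans (m≤n+m (toℕ s) d) d+s≤t
    covered : ∀ z → z < m → z < toℕ s ⊎ toℕ t ≤ z → 1 ≤ used z
    covered z z<m outside = indicator-intro (uses? p z) (co-arc z z<m outside)

module OddCycle (n : ℕ) where

  M T : ℕ
  M = 2 * n + 1
  T = n + n

  M≡1+T : M ≡ suc T
  M≡1+T = 2n+1≡1+[n+n] n
    where
    2n+1≡1+[n+n] : ∀ n → 2 * n + 1 ≡ suc (n + n)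
    2n+1≡1+[n+n] = solve-∀

  instance
    M-nonZero : NonZero M
    M-nonZero = ≢-nonZero (λ M≡0 → 1+n≢0 (trans (sym M≡1+T) M≡0))

  open CycleWalks M

  <M⇒≤T : ∀ {y} → y < M → y ≤ T
  <M⇒≤T {y} y<M = ≤-pred (subst (y <_) M≡1+T y<M)

  T<M : T < M
  T<M = subst (T <_) (sym M≡1+T) ≤-refl

  isSucc-T-0 : IsSucc M (vertex T) (vertex 0)
  isSucc-T-0 = subst (λ i → IsSucc M (vertex i) (vertex 0)) (cong pred M≡1+T) isSucc-wrap

  InArc : ℕ → ℕ → ℕ → Set
  InArc x y z = (y ≤ x + n × x ≤ z × z < y) ⊎ (x + n < y × (y ≤ z ⊎ z < x))

  arc : (x y : ℕ) → Dec (y ≤ x + n) → List (Fin M)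
  arc x y (yes _) = ascending x (y ∸ x)
  arc x y (no _)  = descending x x ++ descending T (T ∸ y)

  arc-walk : ∀ {x y} (short? : Dec (y ≤ x + n)) → x < y → y < M →
             IsWalk (Cycle M) (vertex x) (vertex y) (arc x y short?)
  arc-walk {x} {y} (yes _) x<y y<M =
    subst (λ i → IsWalk (Cycle M) (vertex x) (vertex i) (ascending x (y ∸ x))) (m+[n∸m]≡n (<⇒≤ x<y))
          (ascending-walk x (y ∸ x) (subst (_< M) (sym (m+[n∸m]≡n (<⇒≤ x<y))) y<M))
  arc-walk {x} {y} (no _) x<y y<M =
    walk-++ (subst (λ i → IsWalk (Cycle M) (vertex x) (vertex i) (descending x x)) (n∸n≡0 x)
                   (descending-walk x x ≤-refl (<-trans x<y y<M)))
            (inj₂ isSucc-T-0)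
            (subst (λ i → IsWalk (Cycle M) (vertex T) (vertex i) (descending T (T ∸ y))) (m∸[m∸n]≡n (<M⇒≤T y<M))
                   (descending-walk T (T ∸ y) (m∸n≤m T y) T<M))

  arc-unique : ∀ {x y} (short? : Dec (y ≤ x + n)) → x < y → y < M → Unique (arc x y short?)
  arc-unique {x} {y} (yes _) x<y y<M =
    ascending-unique x (y ∸ x) (subst (_< M) (sym (m+[n∸m]≡n (<⇒≤ x<y))) y<M)
  arc-unique {x} {y} (no _) x<y y<M =
    Unique.++⁺ (descending-unique x x ≤-refl (<-trans x<y y<M))
               (descending-unique T (T ∸ y) (m∸n≤m T y) T<M)
               λ (v∈low , v∈high) →
                 <⇒≱ (≤-<-trans (proj₂ (∈-descending x x ≤-refl (<-trans x<y y<M) v∈low)) x<y)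
                     (subst (_≤ _) (m∸[m∸n]≡n (<M⇒≤T y<M)) (proj₁ (∈-descending T (T ∸ y) (m∸n≤m T y) T<M v∈high)))

  arc-consecutive : ∀ {x y u v} (short? : Dec (y ≤ x + n)) → x < y → y < M →
                    Consecutive u v (arc x y short?) → ∃ λ z → EdgeAt z u v × InArc x y z
  arc-consecutive {x} {y} (yes y≤x+n) x<y y<M c
    with consecutive-ascending x (y ∸ x) (subst (_< M) (sym (m+[n∸m]≡n (<⇒≤ x<y))) y<M) c
  ... | u→v , x≤u , u<y = _ , inj₁ (refl , u→v) , inj₁ (y≤x+n , x≤u , subst (_ <_) (m+[n∸m]≡n (<⇒≤ x<y)) u<y)
  arc-consecutive {x} {y} {u} {v} (no y≰x+n) x<y y<M c with consecutive-++ (descending x x) c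
  ... | inj₁ c-low with consecutive-descending x x ≤-refl (<-trans x<y y<M) c-low
  ...   | v→u , _ , v<x = _ , inj₂ (refl , v→u) , inj₂ (≰⇒> y≰x+n , inj₂ v<x)
  arc-consecutive {x} {y} {u} {v} (no y≰x+n) x<y y<M c | inj₂ (inj₁ (last≡ , head≡)) =
    T , subst₂ (EdgeAt T) 0≡u T≡v (inj₂ (toℕ-vertex T<M , isSucc-T-0)) , inj₂ (≰⇒> y≰x+n , inj₁ (<M⇒≤T y<M))
    where
    0≡u = just-injective (trans (sym (cong (just ∘ vertex) (n∸n≡0 x)))
                                (trans (sym (last-descending x x ≤-refl)) last≡))
    T≡v = just-injective (trans (sym (head-descending T (T ∸ y))) head≡)
  arc-consecutive {x} {y} {u} {v} (no y≰x+n) x<y y<M c | inj₂ (inj₂ c-high)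
    with consecutive-descending T (T ∸ y) (m∸n≤m T y) T<M c-high
  ... | v→u , y≤v , _ =
    _ , inj₂ (refl , v→u) , inj₂ (≰⇒> y≰x+n , inj₁ (subst (_≤ toℕ v) (m∸[m∸n]≡n (<M⇒≤T y<M)) y≤v))

  arc-edge : ∀ {x y u v} (short? : Dec (y ≤ x + n)) → x < y → y < M →
             HasEdge (arc x y short?) u v → ∃ λ z → EdgeAt z u v × InArc x y z
  arc-edge short? x<y y<M (inj₁ c) = arc-consecutive short? x<y y<M c
  arc-edge short? x<y y<M (inj₂ c) with arc-consecutive short? x<y y<M c
  ... | z , inj₁ at , in-arc = z , inj₂ at , in-arc
  ... | z , inj₂ at , in-arc = z , inj₁ at , in-arc

  shortestArcs : PathSystem (Cycle M)
  shortestArcs a b a<b =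
    arc (toℕ a) (toℕ b) short? ,
    subst₂ (λ s t → IsWalk (Cycle M) s t (arc (toℕ a) (toℕ b) short?)) (vertex-toℕ a) (vertex-toℕ b)
           (arc-walk short? a<b (toℕ<n b)) ,
    arc-unique short? a<b (toℕ<n b)
    where short? = toℕ b ≤? toℕ a + n

  fold : ℕ → ℕ
  fold w with w ≤? n
  ... | yes _ = w
  ... | no  _ = w ∸ n

  fold≤n : ∀ {w} → w < M → fold w ≤ n
  fold≤n {w} w<M with w ≤? n
  ... | yes w≤n = w≤n
  ... | no  w≰n = +-cancelʳ-≤ n (w ∸ n) n (subst (_≤ n + n) (sym (m∸n+n≡m (<⇒≤ (≰⇒> w≰n)))) (<M⇒≤T w<M))

  fold≡0 : ∀ {w} → fold w ≡ 0 → w ≡ 0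
  fold≡0 {w} fold≡ with w ≤? n
  ... | yes _   = fold≡
  ... | no  w≰n = ⊥-elim (<-irrefl (sym (trans (sym (m∸n+n≡m (<⇒≤ n<w))) (cong (_+ n) fold≡))) n<w)
    where n<w = ≰⇒> w≰n

  fold-twins< : ∀ {a b} → a < b → fold a ≡ fold b → b ≡ a + n
  fold-twins< {a} {b} a<b fold≡ with a ≤? n | b ≤? n
  ... | yes _   | yes _   = ⊥-elim (<-irrefl fold≡ a<b)
  ... | yes _   | no  b≰n = trans (sym (m∸n+n≡m (<⇒≤ (≰⇒> b≰n)))) (cong (_+ n) (sym fold≡))
  ... | no  a≰n | yes b≤n = ⊥-elim (<⇒≱ (<-trans (≰⇒> a≰n) a<b) b≤n)
  ... | no  a≰n | no  b≰n =
    ⊥-elim (<-irrefl (trans (sym (m∸n+n≡m (<⇒≤ (≰⇒> a≰n))))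
                            (trans (cong (_+ n) fold≡) (m∸n+n≡m (<⇒≤ (≰⇒> b≰n)))))
                     a<b)

  fold-twins : ∀ {a b} → fold a ≡ fold b → a ≡ b ⊎ b ≡ a + n ⊎ a ≡ b + n
  fold-twins {a} {b} fold≡ with <-cmp a b
  ... | tri< a<b _ _ = inj₂ (inj₁ (fold-twins< a<b fold≡))
  ... | tri≈ _ a≡b _ = inj₁ a≡b
  ... | tri> _ _ b<a = inj₂ (inj₂ (fold-twins< b<a (sym fold≡)))

  colour : ℕ → ℕ → ℕ × ℕ
  colour x y with <-cmp (fold x) (fold y)
  ... | tri< _ _ _ = fold x , fold y
  ... | tri≈ _ _ _ = 0 , fold x
  ... | tri> _ _ _ = fold y , fold x

  InClass : ℕ × ℕ → ℕ → Set
  InClass (i , j) w = fold w ≡ i ⊎ fold w ≡ j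

  colour-ends : ∀ x y → InClass (colour x y) x × InClass (colour x y) y
  colour-ends x y with <-cmp (fold x) (fold y)
  ... | tri< _ _     _ = inj₁ refl , inj₂ refl
  ... | tri≈ _ fx≡fy _ = inj₂ refl , inj₂ (sym fx≡fy)
  ... | tri> _ _     _ = inj₂ refl , inj₁ refl

  colour-ordered : ∀ {x y} → x < y → y < M → proj₁ (colour x y) < proj₂ (colour x y) × proj₂ (colour x y) ≤ n
  colour-ordered {x} {y} x<y y<M with <-cmp (fold x) (fold y)
  ... | tri< fx<fy _ _ = fx<fy , fold≤n y<M
  ... | tri≈ _ fx≡fy _ = n≢0⇒n>0 (λ fx≡0 → <-irrefl (trans (fold≡0 fx≡0) (sym (fold≡0 (trans (sym fx≡fy) fx≡0)))) x<y) ,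
                         fold≤n (<-trans x<y y<M)
  ... | tri> _ _ fy<fx = fy<fx , fold≤n (<-trans x<y y<M)

  Interior : ℕ → ℕ → ℕ → Set
  Interior x y w = (y ≤ x + n × x < w × w < y) ⊎ (x + n < y × (y < w ⊎ w < x))

  interior-≢-ends : ∀ {x y w e} → Interior x y w → e ≡ x ⊎ e ≡ y → w ≢ e
  interior-≢-ends (inj₁ (_ , x<w , _))            (inj₁ refl) refl = <-irrefl refl x<w
  interior-≢-ends (inj₁ (_ , _ , w<y))            (inj₂ refl) refl = <-irrefl refl w<y
  interior-≢-ends (inj₂ (x+n<y , inj₁ y<w))       (inj₁ refl) refl = <-asym (≤-<-trans (m≤m+n _ n) x+n<y) y<w
  interior-≢-ends (inj₂ (_ , inj₁ y<w))           (inj₂ refl) refl = <-irrefl refl y<w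
  interior-≢-ends (inj₂ (_ , inj₂ w<x))           (inj₁ refl) refl = <-irrefl refl w<x
  interior-≢-ends (inj₂ (x+n<y , inj₂ w<x))       (inj₂ refl) refl = <-asym (≤-<-trans (m≤m+n _ n) x+n<y) w<x

  interior-≢-end+n : ∀ {x y w e} → w < M → Interior x y w → e ≡ x ⊎ e ≡ y → w ≢ e + n
  interior-≢-end+n _ (inj₁ (y≤x+n , _ , w<y))  (inj₁ refl) refl = <-irrefl refl (<-≤-trans w<y y≤x+n)
  interior-≢-end+n _ (inj₂ (x+n<y , inj₁ y<w)) (inj₁ refl) refl = <-asym x+n<y y<w
  interior-≢-end+n _ (inj₂ (_ , inj₂ w<x))     (inj₁ refl) refl = <⇒≱ w<x (m≤m+n _ n)
  interior-≢-end+n _ (inj₁ (_ , _ , w<y))      (inj₂ refl) refl = <⇒≱ w<y (m≤m+n _ n)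
  interior-≢-end+n {x} w<M (inj₂ (x+n<y , inj₁ _)) (inj₂ refl) refl =
    <⇒≱ (+-monoˡ-< n (≤-<-trans (m≤n+m n x) x+n<y)) (<M⇒≤T w<M)
  interior-≢-end+n _ (inj₂ (x+n<y , inj₂ w<x)) (inj₂ refl) refl =
    <-irrefl refl (<-trans (≤-<-trans (m≤m+n _ n) (<-≤-trans w<x (m≤m+n _ n))) x+n<y)

  interior-end≢+n : ∀ {x y w e} → y < M → Interior x y w → e ≡ x ⊎ e ≡ y → e ≢ w + n
  interior-end≢+n _ (inj₁ (_ , x<w , _))       (inj₁ refl) refl = <⇒≱ x<w (m≤m+n _ n)
  interior-end≢+n _ (inj₂ (x+n<y , inj₁ y<w))  (inj₁ refl) refl = <-asym (<-≤-trans y<w (m≤m+n _ n)) (≤-<-trans (m≤m+n _ n) x+n<y)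
  interior-end≢+n {w = w} y<M (inj₂ (x+n<y , inj₂ _)) (inj₁ refl) refl =
    <⇒≱ (<-≤-trans x+n<y (<M⇒≤T y<M)) (+-monoˡ-≤ n (m≤n+m n w))
  interior-end≢+n _ (inj₁ (y≤x+n , x<w , _))   (inj₂ refl) refl = <⇒≱ x<w (+-cancelʳ-≤ n _ _ y≤x+n)
  interior-end≢+n _ (inj₂ (_ , inj₁ y<w))      (inj₂ refl) refl = <⇒≱ y<w (m≤m+n _ n)
  interior-end≢+n _ (inj₂ (x+n<y , inj₂ w<x))  (inj₂ refl) refl = <-asym (+-monoˡ-< n w<x) x+n<y

  interior-fold≢end : ∀ {x y w e} → y < M → w < M → Interior x y w → e ≡ x ⊎ e ≡ y → fold w ≢ fold e
  interior-fold≢end y<M w<M inside end fold≡ with fold-twins fold≡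
  ... | inj₁ w≡e          = interior-≢-ends inside end w≡e
  ... | inj₂ (inj₁ e≡w+n) = interior-end≢+n y<M inside end e≡w+n
  ... | inj₂ (inj₂ w≡e+n) = interior-≢-end+n w<M inside end w≡e+n

  interior-fold≢0 : ∀ {x y w} → x < y → Interior x y w → fold x ≡ fold y → fold w ≢ 0
  interior-fold≢0 {w = w} x<y inside fx≡fy fw≡0 with fold≡0 {w} fw≡0 | fold-twins< x<y fx≡fy | inside
  ... | refl | refl | inj₁ (_ , () , _)
  ... | refl | refl | inj₂ (_ , inj₁ ())
  ... | refl | refl | inj₂ (x+n<x+n , inj₂ _) = <-irrefl refl x+n<x+n

  interior-avoids-class : ∀ {x y w} → x < y → y < M → w < M → Interior x y w → ¬ InClass (colour x y) w
  interior-avoids-class {x} {y} x<y y<M w<M inside with <-cmp (fold x) (fold y)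
  ... | tri< _ _ _     = [ interior-fold≢end y<M w<M inside (inj₁ refl) , interior-fold≢end y<M w<M inside (inj₂ refl) ]′
  ... | tri≈ _ fx≡fy _ = [ interior-fold≢0 x<y inside fx≡fy , interior-fold≢end y<M w<M inside (inj₁ refl) ]′
  ... | tri> _ _ _     = [ interior-fold≢end y<M w<M inside (inj₂ refl) , interior-fold≢end y<M w<M inside (inj₁ refl) ]′

  Gap : (ℕ → Set) → ℕ → ℕ → Set
  Gap P x y = P x × P y × (∀ w → w < M → Interior x y w → ¬ P w)

  short-and-long-gaps-disjoint : ∀ {P x₁ y₁ x₂ y₂ z} → x₁ < M → y₁ < M → x₂ < M → y₂ < M →
                                 Gap P x₁ y₁ → Gap P x₂ y₂ →
                                 y₁ ≤ x₁ + n × x₁ ≤ z × z < y₁ → x₂ + n < y₂ × (y₂ ≤ z ⊎ z < x₂) → ⊥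
  short-and-long-gaps-disjoint {x₁ = x₁} {y₂ = y₂} x₁<M y₁<M x₂<M y₂<M (Px₁ , Py₁ , empty₁) (Px₂ , Py₂ , empty₂)
                               (y₁≤ , x₁≤z , z<y₁) (x₂+n<y₂ , inj₁ y₂≤z) with <-cmp x₁ y₂
  ... | tri< x₁<y₂ _ _ = empty₁ y₂ y₂<M (inj₁ (y₁≤ , x₁<y₂ , ≤-<-trans y₂≤z z<y₁)) Py₂
  ... | tri≈ _ refl _  = empty₂ _ y₁<M (inj₂ (x₂+n<y₂ , inj₁ (≤-<-trans x₁≤z z<y₁))) Py₁
  ... | tri> _ _ y₂<x₁ = empty₂ x₁ x₁<M (inj₂ (x₂+n<y₂ , inj₁ y₂<x₁)) Px₁
  short-and-long-gaps-disjoint {y₁ = y₁} {x₂ = x₂} x₁<M y₁<M x₂<M y₂<M (Px₁ , Py₁ , empty₁) (Px₂ , Py₂ , empty₂)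
                               (y₁≤ , x₁≤z , z<y₁) (x₂+n<y₂ , inj₂ z<x₂) with <-cmp x₂ y₁
  ... | tri< x₂<y₁ _ _ = empty₁ x₂ x₂<M (inj₁ (y₁≤ , ≤-<-trans x₁≤z z<x₂ , x₂<y₁)) Px₂
  ... | tri≈ _ refl _  = empty₂ _ x₁<M (inj₂ (x₂+n<y₂ , inj₂ (≤-<-trans x₁≤z z<x₂))) Px₁
  ... | tri> _ _ y₁<x₂ = empty₂ y₁ y₁<M (inj₂ (x₂+n<y₂ , inj₂ y₁<x₂)) Py₁

  gaps-sharing-edge-coincide : ∀ {P x₁ y₁ x₂ y₂ z} → x₁ < M → y₁ < M → x₂ < M → y₂ < M →
                               Gap P x₁ y₁ → Gap P x₂ y₂ → InArc x₁ y₁ z → InArc x₂ y₂ z → x₁ ≡ x₂ × y₁ ≡ y₂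
  gaps-sharing-edge-coincide x₁<M y₁<M x₂<M y₂<M gap₁ gap₂ (inj₁ short₁) (inj₂ long₂) =
    ⊥-elim (short-and-long-gaps-disjoint x₁<M y₁<M x₂<M y₂<M gap₁ gap₂ short₁ long₂)
  gaps-sharing-edge-coincide x₁<M y₁<M x₂<M y₂<M gap₁ gap₂ (inj₂ long₁) (inj₁ short₂) =
    ⊥-elim (short-and-long-gaps-disjoint x₂<M y₂<M x₁<M y₁<M gap₂ gap₁ short₂ long₁)
  gaps-sharing-edge-coincide {x₁ = x₁} {y₁} {x₂} {y₂} x₁<M y₁<M x₂<M y₂<M (Px₁ , Py₁ , empty₁) (Px₂ , Py₂ , empty₂)
                             (inj₁ (y₁≤ , x₁≤z , z<y₁)) (inj₁ (y₂≤ , x₂≤z , z<y₂)) = same-start , same-end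
    where
    same-start : x₁ ≡ x₂
    same-start with <-cmp x₁ x₂
    ... | tri< x₁<x₂ _ _ = ⊥-elim (empty₁ x₂ x₂<M (inj₁ (y₁≤ , x₁<x₂ , ≤-<-trans x₂≤z z<y₁)) Px₂)
    ... | tri≈ _ x₁≡x₂ _ = x₁≡x₂
    ... | tri> _ _ x₂<x₁ = ⊥-elim (empty₂ x₁ x₁<M (inj₁ (y₂≤ , x₂<x₁ , ≤-<-trans x₁≤z z<y₂)) Px₁)
    same-end : y₁ ≡ y₂
    same-end with <-cmp y₁ y₂
    ... | tri< y₁<y₂ _ _ = ⊥-elim (empty₂ y₁ y₁<M (inj₁ (y₂≤ , ≤-<-trans x₂≤z z<y₁ , y₁<y₂)) Py₁)
    ... | tri≈ _ y₁≡y₂ _ = y₁≡y₂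
    ... | tri> _ _ y₂<y₁ = ⊥-elim (empty₁ y₂ y₂<M (inj₁ (y₁≤ , ≤-<-trans x₁≤z z<y₂ , y₂<y₁)) Py₂)
  gaps-sharing-edge-coincide {x₁ = x₁} {y₁} {x₂} {y₂} x₁<M y₁<M x₂<M y₂<M (Px₁ , Py₁ , empty₁) (Px₂ , Py₂ , empty₂)
                             (inj₂ (x₁+n<y₁ , _)) (inj₂ (x₂+n<y₂ , _)) = same-start , same-end
    where
    same-start : x₁ ≡ x₂
    same-start with <-cmp x₁ x₂
    ... | tri< x₁<x₂ _ _ = ⊥-elim (empty₂ x₁ x₁<M (inj₂ (x₂+n<y₂ , inj₂ x₁<x₂)) Px₁)
    ... | tri≈ _ x₁≡x₂ _ = x₁≡x₂
    ... | tri> _ _ x₂<x₁ = ⊥-elim (empty₁ x₂ x₂<M (inj₂ (x₁+n<y₁ , inj₂ x₂<x₁)) Px₂)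
    same-end : y₁ ≡ y₂
    same-end with <-cmp y₁ y₂
    ... | tri< y₁<y₂ _ _ = ⊥-elim (empty₁ y₂ y₂<M (inj₂ (x₁+n<y₁ , inj₁ y₁<y₂)) Py₂)
    ... | tri≈ _ y₁≡y₂ _ = y₁≡y₂
    ... | tri> _ _ y₂<y₁ = ⊥-elim (empty₂ y₁ y₁<M (inj₂ (x₂+n<y₂ , inj₁ y₂<y₁)) Py₁)

  colour-gap : ∀ {x y} → x < y → y < M → Gap (InClass (colour x y)) x y
  colour-gap {x} {y} x<y y<M =
    proj₁ (colour-ends x y) , proj₂ (colour-ends x y) , λ w w<M → interior-avoids-class x<y y<M w<M

  colourCode : ℕ → ℕ → ℕ
  colourCode x y = pairCode (proj₁ (colour x y)) (proj₂ (colour x y))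

  colourCode< : ∀ {x y} → x < y → y < M → colourCode x y < (n + 1) C 2
  colourCode< {x} {y} x<y y<M = let i<j , j≤n = colour-ordered x<y y<M in
    subst (λ k → colourCode x y < k C 2) (+-comm 1 n) (pairCode<C2 i<j j≤n)

  colourCode-injective : ∀ {x y x′ y′} → x < y → y < M → x′ < y′ → y′ < M →
                         colourCode x y ≡ colourCode x′ y′ → colour x y ≡ colour x′ y′
  colourCode-injective x<y y<M x′<y′ y′<M code≡ =
    let i≡ , j≡ = pairCode-injective (proj₁ (colour-ordered x<y y<M)) (proj₁ (colour-ordered x′<y′ y′<M)) code≡
    in cong₂ _,_ i≡ j≡

  3≤M : 1 ≤ n → 3 ≤ M
  3≤M 1≤n = subst (3 ≤_) (sym M≡1+T) (s≤s (+-mono-≤ 1≤n 1≤n))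

  shortestArcs-packing : 1 ≤ n → GlobalPacking (Cycle M) shortestArcs ((n + 1) C 2)
  shortestArcs-packing 1≤n = ω , proper
    where
    ω : (a b : Fin M) → a Fin.< b → Fin ((n + 1) C 2)
    ω a b a<b = fromℕ< (colourCode< a<b (toℕ<n b))

    proper : ∀ a b a′ b′ (a<b : a Fin.< b) (a′<b′ : a′ Fin.< b′) → ¬ (a ≡ a′ × b ≡ b′) →
             ShareEdge (pathOf shortestArcs a b a<b) (pathOf shortestArcs a′ b′ a′<b′) → ω a b a<b ≢ ω a′ b′ a′<b′
    proper a b a′ b′ a<b a′<b′ distinct (u , v , e , e′) ω≡ =
      distinct (toℕ-injective (proj₁ same) , toℕ-injective (proj₂ same))
      where
      edge  = arc-edge (toℕ b ≤? toℕ a + n) a<b (toℕ<n b) e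
      edge′ = arc-edge (toℕ b′ ≤? toℕ a′ + n) a′<b′ (toℕ<n b′) e′
      z≡z′ : proj₁ edge ≡ proj₁ edge′
      z≡z′ = EdgeAt-unique (3≤M 1≤n) (proj₁ (proj₂ edge)) (proj₁ (proj₂ edge′))
      code≡ : colourCode (toℕ a) (toℕ b) ≡ colourCode (toℕ a′) (toℕ b′)
      code≡ = trans (sym (toℕ-fromℕ< (colourCode< a<b (toℕ<n b))))
                    (trans (cong toℕ ω≡) (toℕ-fromℕ< (colourCode< a′<b′ (toℕ<n b′))))
      colour≡ : colour (toℕ a) (toℕ b) ≡ colour (toℕ a′) (toℕ b′)
      colour≡ = colourCode-injective a<b (toℕ<n b) a′<b′ (toℕ<n b′) code≡
      same = gaps-sharing-edge-coincide (toℕ<n a) (toℕ<n b) (toℕ<n a′) (toℕ<n b′)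
               (colour-gap a<b (toℕ<n b))
               (subst (λ c → Gap (InClass c) (toℕ a′) (toℕ b′)) (sym colour≡) (colour-gap a′<b′ (toℕ<n b′)))
               (proj₂ (proj₂ edge)) (subst (InArc (toℕ a′) (toℕ b′)) (sym z≡z′) (proj₂ (proj₂ edge′)))

  pairAt : ℕ → ℕ → ℕ × ℕ
  pairAt a ℓ with a + suc ℓ <? M
  ... | yes _ = a , a + suc ℓ
  ... | no  _ = a + suc ℓ ∸ M , a

  2+ℓ+ℓ′<M : ∀ {ℓ ℓ′} → ℓ < n → ℓ′ < n → suc ℓ + suc ℓ′ < M
  2+ℓ+ℓ′<M {ℓ} {ℓ′} ℓ<n ℓ′<n = subst (suc ℓ + suc ℓ′ <_) (sym M≡1+T) (s≤s (+-mono-≤ ℓ<n ℓ′<n))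

  pairAt-spec : ∀ {a ℓ} → a < M → ℓ < n → let (lo , hi) = pairAt a ℓ in
                lo < hi × hi < M × suc ℓ + lo ≤ hi × suc ℓ + hi ≤ lo + M
  pairAt-spec {a} {ℓ} a<M ℓ<n with a + suc ℓ <? M
  ... | yes a+s<M = m<m+n a z<s , a+s<M , ≤-reflexive (+-comm (suc ℓ) a) ,
                    subst (_≤ a + M) (sym (swap-middle (suc ℓ) a)) (+-monoʳ-≤ a (<⇒≤ (2+ℓ+ℓ′<M ℓ<n ℓ<n)))
    where
    swap-middle : ∀ s a → s + (a + s) ≡ a + (s + s)
    swap-middle = solve-∀
  ... | no  a+s≮M = <-≤-trans (m<m+n L z<s) (subst (_≤ a) (+-comm (suc ℓ) L) s+L≤a) , a<M , s+L≤a ,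
                    subst (suc ℓ + a ≤_) (sym L+M≡a+s) (≤-reflexive (+-comm (suc ℓ) a))
    where
    L = a + suc ℓ ∸ M
    L+M≡a+s : L + M ≡ a + suc ℓ
    L+M≡a+s = m∸n+n≡m (≮⇒≥ a+s≮M)
    rearrange : ∀ s L → (s + L) + s ≡ L + (s + s)
    rearrange = solve-∀
    s+L≤a : suc ℓ + L ≤ a
    s+L≤a = +-cancelʳ-≤ (suc ℓ) (suc ℓ + L) a
              (subst (_≤ a + suc ℓ) (sym (rearrange (suc ℓ) L))
                (subst (L + (suc ℓ + suc ℓ) ≤_) L+M≡a+s (+-monoʳ-≤ L (<⇒≤ (2+ℓ+ℓ′<M ℓ<n ℓ<n)))))

  wrapped-pairs-distinct : ∀ {a ℓ a′ ℓ′} → ℓ < n → ℓ′ < n → M ≤ a′ + suc ℓ′ →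
                           a′ + suc ℓ′ ∸ M ≡ a → a + suc ℓ ≡ a′ → ⊥
  wrapped-pairs-distinct {a} {ℓ} {a′} {ℓ′} ℓ<n ℓ′<n M≤ lo≡ hi≡ = <-irrefl (sym M≡s+s′) (2+ℓ+ℓ′<M ℓ<n ℓ′<n)
    where
    open ≡-Reasoning
    M≡s+s′ : M ≡ suc ℓ + suc ℓ′
    M≡s+s′ = +-cancelˡ-≡ a M (suc ℓ + suc ℓ′) (begin
      a + M                     ≡⟨ cong (_+ M) (sym lo≡) ⟩
      a′ + suc ℓ′ ∸ M + M       ≡⟨ m∸n+n≡m M≤ ⟩
      a′ + suc ℓ′               ≡⟨ cong (_+ suc ℓ′) (sym hi≡) ⟩
      a + suc ℓ + suc ℓ′        ≡⟨ +-assoc a (suc ℓ) (suc ℓ′) ⟩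
      a + (suc ℓ + suc ℓ′)      ∎)

  pairAt-injective : ∀ {a ℓ a′ ℓ′} → ℓ < n → ℓ′ < n → pairAt a ℓ ≡ pairAt a′ ℓ′ → a ≡ a′ × ℓ ≡ ℓ′
  pairAt-injective {a} {ℓ} {a′} {ℓ′} ℓ<n ℓ′<n pair≡ with a + suc ℓ <? M | a′ + suc ℓ′ <? M
  ... | yes _    | yes _     with cong proj₁ pair≡
  ...   | refl = refl , suc-injective (+-cancelˡ-≡ a _ _ (cong proj₂ pair≡))
  pairAt-injective ℓ<n ℓ′<n pair≡ | yes _ | no a′+s′≮M =
    ⊥-elim (wrapped-pairs-distinct ℓ<n ℓ′<n (≮⇒≥ a′+s′≮M) (cong proj₁ (sym pair≡)) (cong proj₂ pair≡))
  pairAt-injective ℓ<n ℓ′<n pair≡ | no a+s≮M | yes _ =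
    ⊥-elim (wrapped-pairs-distinct ℓ′<n ℓ<n (≮⇒≥ a+s≮M) (cong proj₁ pair≡) (cong proj₂ (sym pair≡)))
  pairAt-injective {a} {ℓ} {a′} {ℓ′} ℓ<n ℓ′<n pair≡ | no a+s≮M | no a′+s′≮M with cong proj₂ pair≡
  ...   | refl = refl , suc-injective (+-cancelˡ-≡ a _ _ (begin
    a + suc ℓ           ≡⟨ sym (m∸n+n≡m (≮⇒≥ a+s≮M)) ⟩
    a + suc ℓ ∸ M + M   ≡⟨ cong (_+ M) (cong proj₁ pair≡) ⟩
    a + suc ℓ′ ∸ M + M  ≡⟨ m∸n+n≡m (≮⇒≥ a′+s′≮M) ⟩
    a + suc ℓ′          ∎))
    where open ≡-Reasoning

  module LowerBound (P : PathSystem (Cycle M)) {k : ℕ} (packing : GlobalPacking (Cycle M) P k) where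

    ω : (a b : Fin M) → a Fin.< b → Fin k
    ω = proj₁ packing

    Lo Hi : ℕ → ℕ → Fin M
    Lo a ℓ = vertex (proj₁ (pairAt a ℓ))
    Hi a ℓ = vertex (proj₂ (pairAt a ℓ))

    ordered? : ∀ a ℓ → Dec (Lo a ℓ Fin.< Hi a ℓ)
    ordered? a ℓ = toℕ (Lo a ℓ) <? toℕ (Hi a ℓ)

    -- The no-branches never occur for a < M and ℓ < n (see Lo<Hi); they only make these total.
    path : (u v : Fin M) → Dec (u Fin.< v) → List (Fin M)
    path u v (yes u<v) = pathOf P u v u<v
    path u v (no _)    = []

    colourOf : (u v : Fin M) → Dec (u Fin.< v) → ℕ
    colourOf u v (yes u<v) = toℕ (ω u v u<v)
    colourOf u v (no _)    = 0

    uses : ℕ → ℕ → ℕ → ℕ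
    uses z a ℓ = indicator (uses? (path (Lo a ℓ) (Hi a ℓ) (ordered? a ℓ)) z)

    pairColour : ℕ → ℕ → ℕ
    pairColour a ℓ = colourOf (Lo a ℓ) (Hi a ℓ) (ordered? a ℓ)

    toℕ-Lo : ∀ {a ℓ} → a < M → ℓ < n → toℕ (Lo a ℓ) ≡ proj₁ (pairAt a ℓ)
    toℕ-Lo a<M ℓ<n = let lo<hi , hi<M , _ = pairAt-spec a<M ℓ<n in toℕ-vertex (<-trans lo<hi hi<M)

    toℕ-Hi : ∀ {a ℓ} → a < M → ℓ < n → toℕ (Hi a ℓ) ≡ proj₂ (pairAt a ℓ)
    toℕ-Hi a<M ℓ<n = toℕ-vertex (proj₁ (proj₂ (pairAt-spec a<M ℓ<n)))

    Lo<Hi : ∀ {a ℓ} → a < M → ℓ < n → Lo a ℓ Fin.< Hi a ℓ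
    Lo<Hi a<M ℓ<n = subst₂ _<_ (sym (toℕ-Lo a<M ℓ<n)) (sym (toℕ-Hi a<M ℓ<n)) (proj₁ (pairAt-spec a<M ℓ<n))

    path-uses-edges : ∀ {u v d} (u<v? : Dec (u Fin.< v)) → u Fin.< v →
                      d + toℕ u ≤ toℕ v → d + toℕ v ≤ toℕ u + M → d ≤ usedEdges (path u v u<v?)
    path-uses-edges (yes u<v) _   = walk-usedEdges (proj₁ (proj₂ (P _ _ u<v)))
    path-uses-edges (no u≮v)  u<v = ⊥-elim (u≮v u<v)

    pair-uses-edges : ∀ {a ℓ} → a < M → ℓ < n → suc ℓ ≤ ∑[ z < M ] uses z a ℓ
    pair-uses-edges {a} {ℓ} a<M ℓ<n =
      path-uses-edges (ordered? a ℓ) (Lo<Hi a<M ℓ<n)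
        (subst₂ (λ lo hi → suc ℓ + lo ≤ hi) (sym (toℕ-Lo a<M ℓ<n)) (sym (toℕ-Hi a<M ℓ<n)) near)
        (subst₂ (λ lo hi → suc ℓ + hi ≤ lo + M) (sym (toℕ-Lo a<M ℓ<n)) (sym (toℕ-Hi a<M ℓ<n)) far)
      where
      near = proj₁ (proj₂ (proj₂ (pairAt-spec a<M ℓ<n)))
      far  = proj₂ (proj₂ (proj₂ (pairAt-spec a<M ℓ<n)))

    colourOf<k : ∀ {u v} (u<v? : Dec (u Fin.< v)) → u Fin.< v → colourOf u v u<v? < k
    colourOf<k (yes u<v) _   = toℕ<n (ω _ _ u<v)
    colourOf<k (no u≮v)  u<v = ⊥-elim (u≮v u<v)

    pairColour<k : ∀ a ℓ → a < M → ℓ < n → pairColour a ℓ < k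
    pairColour<k a ℓ a<M ℓ<n = colourOf<k (ordered? a ℓ) (Lo<Hi a<M ℓ<n)

    same-edge-same-colour : ∀ z {u v u′ v′} (d : Dec (u Fin.< v)) (d′ : Dec (u′ Fin.< v′)) →
                            Uses (path u v d) z → Uses (path u′ v′ d′) z → colourOf u v d ≡ colourOf u′ v′ d′ →
                            u ≡ u′ × v ≡ v′
    same-edge-same-colour z (yes u<v) (yes u′<v′) e e′ colour≡ =
      packing-separates (Cycle M) P packing u<v u′<v′ e e′ (toℕ-injective {k} colour≡)
    same-edge-same-colour z (no _)    _           (inj₁ ()) _ _
    same-edge-same-colour z (no _)    _           (inj₂ ()) _ _
    same-edge-same-colour z (yes _)   (no _)      _ (inj₁ ()) _
    same-edge-same-colour z (yes _)   (no _)      _ (inj₂ ()) _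

    edge-separates-pairs : ∀ z a ℓ a′ ℓ′ → a < M → ℓ < n → a′ < M → ℓ′ < n →
                           1 ≤ uses z a ℓ → 1 ≤ uses z a′ ℓ′ → pairColour a ℓ ≡ pairColour a′ ℓ′ → a ≡ a′ × ℓ ≡ ℓ′
    edge-separates-pairs z a ℓ a′ ℓ′ a<M ℓ<n a′<M ℓ′<n used used′ colour≡ =
      pairAt-injective ℓ<n ℓ′<n (cong₂ _,_ (trans (sym (toℕ-Lo a<M ℓ<n)) (trans (cong toℕ Lo≡) (toℕ-Lo a′<M ℓ′<n)))
                                           (trans (sym (toℕ-Hi a<M ℓ<n)) (trans (cong toℕ Hi≡) (toℕ-Hi a′<M ℓ′<n))))
      where
      Lo≡Hi≡ = same-edge-same-colour z (ordered? a ℓ) (ordered? a′ ℓ′)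
                 (indicator-elim (uses? _ z) used) (indicator-elim (uses? _ z) used′) colour≡
      Lo≡ = proj₁ Lo≡Hi≡
      Hi≡ = proj₂ Lo≡Hi≡

    edge-load≤k : ∀ z → ∑[ a < M ] ∑[ ℓ < n ] uses z a ℓ ≤ k
    edge-load≤k z = ∑∑-injective-colouring-≤ M n k (uses z) pairColour
      (λ a ℓ _ _ → indicator≤1 (uses? _ z)) pairColour<k (edge-separates-pairs z)

    lower-bound : (n + 1) C 2 ≤ k
    lower-bound = *-cancelˡ-≤ M (begin
      M * ((n + 1) C 2)                             ≡⟨ cong (λ j → M * (j C 2)) (+-comm n 1) ⟩
      M * (suc n C 2)                               ≡⟨ cong (M *_) (sym (∑-suc≡C2 n)) ⟩
      M * ∑[ ℓ < n ] suc ℓ                          ≡⟨ sym (∑-const M _) ⟩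
      ∑[ a < M ] ∑[ ℓ < n ] suc ℓ                   ≤⟨ ∑-mono-≤ M (λ a a<M → ∑-mono-≤ n λ ℓ ℓ<n → pair-uses-edges a<M ℓ<n) ⟩
      ∑[ a < M ] ∑[ ℓ < n ] ∑[ z < M ] uses z a ℓ   ≡⟨ ∑-cong M (λ a _ → ∑-comm n M λ ℓ z → uses z a ℓ) ⟩
      ∑[ a < M ] ∑[ z < M ] ∑[ ℓ < n ] uses z a ℓ   ≡⟨ ∑-comm M M (λ a z → ∑[ ℓ < n ] uses z a ℓ) ⟩
      ∑[ z < M ] ∑[ a < M ] ∑[ ℓ < n ] uses z a ℓ   ≤⟨ ∑-mono-≤ M (λ z _ → edge-load≤k z) ⟩
      ∑[ z < M ] k                                  ≡⟨ ∑-const M k ⟩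
      M * k                                         ∎)
      where open ≤-Reasoning

theorem2 : (n : ℕ) → 1 ≤ n → Phi≡ (Cycle (2 * n + 1)) ((n + 1) C 2)
theorem2 n 1≤n =
  (shortestArcs , shortestArcs-packing 1≤n) , λ P k packing → LowerBound.lower-bound P packing
  where open OddCycle n
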